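{- Let $n\ge 2k$, $k\ge1$. Then $m(1,J(n,k))\le \frac{n-k}{\gcd(n,k)}+1$.
   Context: $J(n,k)$ is the Johnson graph on the $k$-subsets of $\{1,\dots,n\}$ (adjacent iff they meet in $k-1$ elements); $\theta_1(J(n,k))=(k-1)(n-k-1)-1$ is its second largest eigenvalue. NZI means all entries nonzero integers; $m(1,J(n,k))=\min\{\|v\|_\infty+1: v\text{ an NZI }\theta_1(J(n,k))\text{ -eigenvector of }J(n,k)\}$. -}

module Defs where

open import Data.Nat as ℕ using (ℕ; zero; suc; _∸_; NonZero; ≢-nonZero; ≢-nonZero⁻¹)
open import Data.Nat.DivMod using (_/_)
open import Data.Nat.GCD using (gcd; gcd[m,n]≢0)
open import Data.Integer as ℤ using (ℤ; +_; 0ℤ; 1ℤ)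
open import Data.Fin.Subset using (Subset; inside; outside; _∩_; ∣_∣)
open import Data.Vec using ([]; _∷_)
open import Data.List using (List; [_]; map; _++_; filter; foldr)
open import Data.Product using (_×_)
open import Data.Sum using (inj₂)
open import Relation.Nullary using (¬_)
open import Relation.Nullary.Decidable using (Dec; _×-dec_)
open import Relation.Binary.PropositionalEquality using (_≡_)

allSubsets : (n : ℕ) → List (Subset n)
allSubsets zero = [ [] ]
allSubsets (suc n) = map (outside ∷_) (allSubsets n) ++ map (inside ∷_) (allSubsets n)

IsVertex : (n k : ℕ) → Subset n → Set
IsVertex n k S = ∣ S ∣ ≡ k

Adjacent : (n k : ℕ) → Subset n → Subset n → Set
Adjacent n k S T = ∣ S ∣ ≡ k × ∣ T ∣ ≡ k × ∣ S ∩ T ∣ ≡ k ∸ 1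

adjacent? : (n k : ℕ) → (S T : Subset n) → Dec (Adjacent n k S T)
adjacent? n k S T = (∣ S ∣ ℕ.≟ k) ×-dec ((∣ T ∣ ℕ.≟ k) ×-dec (∣ S ∩ T ∣ ℕ.≟ (k ∸ 1)))

sumℤ : List ℤ → ℤ
sumℤ = foldr ℤ._+_ 0ℤ

adjApply : (n k : ℕ) → (Subset n → ℤ) → Subset n → ℤ
adjApply n k v S = sumℤ (map v (filter (adjacent? n k S) (allSubsets n)))

θ₁ : (n k : ℕ) → ℤ
θ₁ n k = ((+ k) ℤ.- 1ℤ) ℤ.* ((+ n) ℤ.- (+ k) ℤ.- 1ℤ) ℤ.- 1ℤ

-- v (a function on the vertex set; values off the k-subsets are irrelevant)
-- is an NZI θ-eigenvector of J(n,k).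
IsNZIEigenvector : (n k : ℕ) → ℤ → (Subset n → ℤ) → Set
IsNZIEigenvector n k θ v =
  ((S : Subset n) → IsVertex n k S → ¬ (v S ≡ 0ℤ)) ×
  ((S : Subset n) → IsVertex n k S → adjApply n k v S ≡ θ ℤ.* v S)

SupNormLE : (n k : ℕ) → (Subset n → ℤ) → ℕ → Set
SupNormLE n k v b = (S : Subset n) → IsVertex n k S → ℤ.∣ v S ∣ ℕ.≤ b

-- The bound (n-k)/gcd(n,k) (exact division; gcd(n,k) ≠ 0 since k ≠ 0).
johnsonBound : (n k : ℕ) → .{{NonZero k}} → ℕ
johnsonBound n k {{nz}} =
  _/_ (n ∸ k) (gcd n k) {{≢-nonZero (gcd[m,n]≢0 n k (inj₂ (≢-nonZero⁻¹ k {{nz}})))}}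

{-# OPTIONS --safe #-}
-- Fix the point 0 and g = gcd(n,k). The vector equal to (n-k)/g on the k-sets containing 0
-- and to -k/g on the others is a θ₁-eigenvector of J(n,k): a k-set containing 0 has n-k
-- neighbours avoiding 0 and (k-1)(n-k) containing it, one avoiding 0 has k(n-k-1) neighbours
-- avoiding 0 and k containing it, and both eigenvalue equations reduce to
-- k · (n-k)/g = (k/g) · (n-k). As n ≥ 2k, its largest absolute entry is (n-k)/g.
-- The neighbour counts are instances of: the sets T obtained from S by removing d and adding
-- e elements number C(|S|,d) · C(|∁S|,e).
module Submission where

open import Defs
open import Data.Nat as ℕ using (ℕ; zero; suc; _+_; _*_; _∸_; _≤_; NonZero)
open import Data.Nat.Properties
  using (suc-injective; +-suc; +-comm; +-identityʳ; +-cancelʳ-≡; *-comm; *-identityˡ; *-identityʳ;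
         *-distribˡ-+; *-distribʳ-+; +-∸-assoc; m+[n∸m]≡n; ≤-refl; ≤-trans; ≤-reflexive;
         m+n≤o⇒m≤o; m+n≤o⇒m≤o∸n; n>0⇒n≢0)
open import Data.Nat.Combinatorics using (_C_; nC1≡n; k>n⇒nCk≡0; nCk+nC[k+1]≡[n+1]C[k+1])
open import Data.Nat.Divisibility using (_∣_; ∣⇒≤; ∣m+n∣m⇒∣n)
open import Data.Nat.DivMod using (_/_; /-congˡ; *-/-assoc; /-monoˡ-≤; m≥n⇒m/n>0)
open import Data.Nat.GCD using (gcd; gcd[m,n]≢0; gcd[m,n]∣m; gcd[m,n]∣n)
open import Data.Integer as ℤ using (ℤ; +_; -_; 0ℤ; 1ℤ)
import Data.Integer.Properties as ℤ
open import Data.Integer.Tactic.RingSolver using (solve-∀)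
open import Data.Fin.Subset using (Subset; inside; outside; _∩_; ∁; ∣_∣)
open import Data.Fin.Subset.Properties using (∩-comm; ∣p∣≤n; ∣∁p∣≡n∸∣p∣)
open import Data.Bool using (true; false)
open import Data.Vec using ([]; _∷_)
open import Data.List using (List; []; _∷_; map; filter; length; _++_)
open import Data.List.Properties using (length-++; filter-++; filter-none; filter-≐; map-++)
open import Data.List.Relation.Unary.All using (universal)
open import Data.Product using (Σ; _×_; _,_; map₁; map₂; proj₁; proj₂)
open import Data.Sum using (inj₂)
open import Function using (_∘_; _⇔_; mk⇔; Equivalence)
open import Level using (Level; 0ℓ)
open import Relation.Nullary using (¬_; does)
open import Relation.Nullary.Decidable using (_×-dec_)
open import Relation.Unary using (Pred; Decidable; _≐_)
open import Relation.Binary.PropositionalEquality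
open ≡-Reasoning

private
  variable
    a p q : Level
    A B : Set a

count : {P : Pred A p} → Decidable P → List A → ℕ
count P? = length ∘ filter P?

module _ {P : Pred A p} (P? : Decidable P) where

  count-++ : ∀ xs ys → count P? (xs ++ ys) ≡ count P? xs + count P? ys
  count-++ xs ys = trans (cong length (filter-++ P? xs ys)) (length-++ (filter P? xs))

  count-none : (∀ x → ¬ P x) → ∀ xs → count P? xs ≡ 0
  count-none ¬P xs = cong length (filter-none P? (universal ¬P xs))

  count-map : (f : B → A) → ∀ xs → count P? (map f xs) ≡ count (P? ∘ f) xs
  count-map f [] = refl
  count-map f (x ∷ xs) with does (P? (f x))
  ... | true = cong suc (count-map f xs)
  ... | false = count-map f xs

count-≐ : {P : Pred A p} {Q : Pred A q} (P? : Decidable P) (Q? : Decidable Q) →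
  P ≐ Q → ∀ xs → count P? xs ≡ count Q? xs
count-≐ P? Q? P≐Q xs = cong length (filter-≐ P? Q? P≐Q xs)

count-allSubsets : ∀ {m} {P : Pred (Subset (suc m)) p} (P? : Decidable P) → count P? (allSubsets (suc m))
  ≡ count (P? ∘ (outside ∷_)) (allSubsets m) + count (P? ∘ (inside ∷_)) (allSubsets m)
count-allSubsets {m = m} P? = trans (count-++ P? (map (outside ∷_) (allSubsets m)) _)
  (cong₂ _+_ (count-map P? (outside ∷_) (allSubsets m)) (count-map P? (inside ∷_) (allSubsets m)))

sumℤ-++ : ∀ xs ys → sumℤ (xs ++ ys) ≡ sumℤ xs ℤ.+ sumℤ ys
sumℤ-++ [] ys = sym (ℤ.+-identityˡ (sumℤ ys))
sumℤ-++ (x ∷ xs) ys = trans (cong (λ s → x ℤ.+ s) (sumℤ-++ xs ys)) (sym (ℤ.+-assoc x (sumℤ xs) (sumℤ ys)))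

sumℤ-filter-map-const : {P : Pred A p} (P? : Decidable P) (f : B → A) (v : A → ℤ) {c : ℤ} →
  (∀ y → v (f y) ≡ c) → ∀ ys → sumℤ (map v (filter P? (map f ys))) ≡ + count (P? ∘ f) ys ℤ.* c
sumℤ-filter-map-const P? f v v∘f≡c [] = refl
sumℤ-filter-map-const P? f v {c} v∘f≡c (y ∷ ys) with does (P? (f y))
... | false = sumℤ-filter-map-const P? f v v∘f≡c ys
... | true = begin
  v (f y) ℤ.+ sumℤ (map v (filter P? (map f ys)))
    ≡⟨ cong₂ ℤ._+_ (v∘f≡c y) (sumℤ-filter-map-const P? f v v∘f≡c ys) ⟩
  c ℤ.+ + n ℤ.* c
    ≡⟨ cong (ℤ._+ + n ℤ.* c) (ℤ.*-identityˡ c) ⟨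
  1ℤ ℤ.* c ℤ.+ + n ℤ.* c
    ≡⟨ ℤ.*-distribʳ-+ c 1ℤ (+ n) ⟨
  + suc n ℤ.* c ∎
  where
  n : ℕ
  n = count (P? ∘ f) ys

∣p∣≡∣p∩∁q∣+∣p∩q∣ : ∀ {m} (p q : Subset m) → ∣ p ∣ ≡ ∣ p ∩ ∁ q ∣ + ∣ p ∩ q ∣
∣p∣≡∣p∩∁q∣+∣p∩q∣ [] [] = refl
∣p∣≡∣p∩∁q∣+∣p∩q∣ (inside ∷ p) (inside ∷ q) =
  trans (cong suc (∣p∣≡∣p∩∁q∣+∣p∩q∣ p q)) (sym (+-suc ∣ p ∩ ∁ q ∣ ∣ p ∩ q ∣))
∣p∣≡∣p∩∁q∣+∣p∩q∣ (inside ∷ p) (outside ∷ q) = cong suc (∣p∣≡∣p∩∁q∣+∣p∩q∣ p q)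
∣p∣≡∣p∩∁q∣+∣p∩q∣ (outside ∷ p) (_ ∷ q) = ∣p∣≡∣p∩∁q∣+∣p∩q∣ p q

∣p∩∁q∣≡1⇔∣p∩q∣≡k : ∀ {m k} (p q : Subset m) → ∣ p ∣ ≡ suc k → ∣ p ∩ ∁ q ∣ ≡ 1 ⇔ ∣ p ∩ q ∣ ≡ k
∣p∩∁q∣≡1⇔∣p∩q∣≡k {k = k} p q ∣p∣≡1+k = mk⇔
  (λ ∣p∩∁q∣≡1 → suc-injective (sym (trans (sym ∣p∣≡1+k)
    (trans (∣p∣≡∣p∩∁q∣+∣p∩q∣ p q) (cong (_+ ∣ p ∩ q ∣) ∣p∩∁q∣≡1)))))
  (λ ∣p∩q∣≡k → +-cancelʳ-≡ k ∣ p ∩ ∁ q ∣ 1 (trans (cong (λ t → ∣ p ∩ ∁ q ∣ + t) (sym ∣p∩q∣≡k))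
    (trans (sym (∣p∣≡∣p∩∁q∣+∣p∩q∣ p q)) ∣p∣≡1+k)))

Differs : ∀ {m} → Subset m → ℕ → ℕ → Pred (Subset m) 0ℓ
Differs S d e T = ∣ S ∩ ∁ T ∣ ≡ d × ∣ T ∩ ∁ S ∣ ≡ e

differs? : ∀ {m} (S : Subset m) d e → Decidable (Differs S d e)
differs? S d e T = (∣ S ∩ ∁ T ∣ ℕ.≟ d) ×-dec (∣ T ∩ ∁ S ∣ ℕ.≟ e)

module _ {m} (S : Subset m) where

  count-differs-inside-outside : ∀ d e xs →
    count (differs? (inside ∷ S) (suc d) e ∘ (outside ∷_)) xs ≡ count (differs? S d e) xs
  count-differs-inside-outside d e =
    count-≐ (differs? (inside ∷ S) (suc d) e ∘ (outside ∷_)) (differs? S d e)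
      (map₁ suc-injective , map₁ (cong suc))

  count-differs-outside-inside : ∀ d e xs →
    count (differs? (outside ∷ S) d (suc e) ∘ (inside ∷_)) xs ≡ count (differs? S d e) xs
  count-differs-outside-inside d e =
    count-≐ (differs? (outside ∷ S) d (suc e) ∘ (inside ∷_)) (differs? S d e)
      (map₂ suc-injective , map₂ (cong suc))

count-Differs : ∀ {m} (S : Subset m) d e → count (differs? S d e) (allSubsets m) ≡ (∣ S ∣ C d) * (∣ ∁ S ∣ C e)
count-Differs [] zero zero = refl
count-Differs [] zero (suc e) = sym (trans (*-identityˡ (0 C suc e)) (k>n⇒nCk≡0 {0} {suc e} ℕ.z<s))
count-Differs [] (suc d) e = sym (cong (_* (0 C e)) (k>n⇒nCk≡0 {0} {suc d} ℕ.z<s))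
count-Differs {suc m} (inside ∷ S) zero e = begin
  count (differs? (inside ∷ S) 0 e) (allSubsets (suc m))
    ≡⟨ count-allSubsets (differs? (inside ∷ S) 0 e) ⟩
  count (differs? (inside ∷ S) 0 e ∘ (outside ∷_)) (allSubsets m) + count (differs? S 0 e) (allSubsets m)
    ≡⟨ cong₂ _+_ (count-none (differs? (inside ∷ S) 0 e ∘ (outside ∷_)) (λ { _ (() , _) }) (allSubsets m))
                 (count-Differs S 0 e) ⟩
  (∣ S ∣ C 0) * (∣ ∁ S ∣ C e) ∎
count-Differs {suc m} (inside ∷ S) (suc d) e = begin
  count (differs? (inside ∷ S) (suc d) e) (allSubsets (suc m))
    ≡⟨ count-allSubsets (differs? (inside ∷ S) (suc d) e) ⟩
  count (differs? (inside ∷ S) (suc d) e ∘ (outside ∷_)) (allSubsets m) + count (differs? S (suc d) e) (allSubsets m)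
    ≡⟨ cong₂ _+_ (trans (count-differs-inside-outside S d e (allSubsets m)) (count-Differs S d e))
                 (count-Differs S (suc d) e) ⟩
  (∣ S ∣ C d) * (∣ ∁ S ∣ C e) + (∣ S ∣ C suc d) * (∣ ∁ S ∣ C e)
    ≡⟨ *-distribʳ-+ (∣ ∁ S ∣ C e) (∣ S ∣ C d) (∣ S ∣ C suc d) ⟨
  (∣ S ∣ C d + ∣ S ∣ C suc d) * (∣ ∁ S ∣ C e)
    ≡⟨ cong (_* (∣ ∁ S ∣ C e)) (nCk+nC[k+1]≡[n+1]C[k+1] ∣ S ∣ d) ⟩
  (suc ∣ S ∣ C suc d) * (∣ ∁ S ∣ C e) ∎
count-Differs {suc m} (outside ∷ S) d zero = begin
  count (differs? (outside ∷ S) d 0) (allSubsets (suc m))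
    ≡⟨ count-allSubsets (differs? (outside ∷ S) d 0) ⟩
  count (differs? S d 0) (allSubsets m) + count (differs? (outside ∷ S) d 0 ∘ (inside ∷_)) (allSubsets m)
    ≡⟨ cong₂ _+_ (count-Differs S d 0)
                 (count-none (differs? (outside ∷ S) d 0 ∘ (inside ∷_)) (λ { _ (_ , ()) }) (allSubsets m)) ⟩
  (∣ S ∣ C d) * (∣ ∁ S ∣ C 0) + 0
    ≡⟨ +-identityʳ _ ⟩
  (∣ S ∣ C d) * (suc ∣ ∁ S ∣ C 0) ∎
count-Differs {suc m} (outside ∷ S) d (suc e) = begin
  count (differs? (outside ∷ S) d (suc e)) (allSubsets (suc m))
    ≡⟨ count-allSubsets (differs? (outside ∷ S) d (suc e)) ⟩
  count (differs? S d (suc e)) (allSubsets m) + count (differs? (outside ∷ S) d (suc e) ∘ (inside ∷_)) (allSubsets m)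
    ≡⟨ cong₂ _+_ (count-Differs S d (suc e))
                 (trans (count-differs-outside-inside S d e (allSubsets m)) (count-Differs S d e)) ⟩
  (∣ S ∣ C d) * (∣ ∁ S ∣ C suc e) + (∣ S ∣ C d) * (∣ ∁ S ∣ C e)
    ≡⟨ *-distribˡ-+ (∣ S ∣ C d) (∣ ∁ S ∣ C suc e) (∣ ∁ S ∣ C e) ⟨
  (∣ S ∣ C d) * (∣ ∁ S ∣ C suc e + ∣ ∁ S ∣ C e)
    ≡⟨ cong ((∣ S ∣ C d) *_) (trans (+-comm (∣ ∁ S ∣ C suc e) _) (nCk+nC[k+1]≡[n+1]C[k+1] ∣ ∁ S ∣ e)) ⟩
  (∣ S ∣ C d) * (suc ∣ ∁ S ∣ C suc e) ∎

adjacent≐differs : ∀ {n k} (S : Subset n) → ∣ S ∣ ≡ suc k → Adjacent n (suc k) S ≐ Differs S 1 1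
adjacent≐differs {n} {k} S ∣S∣≡1+k = toDiffers , fromDiffers
  where
  open Equivalence
  ∣T∩S∣≡∣S∩T∣ : ∀ T → ∣ T ∩ S ∣ ≡ ∣ S ∩ T ∣
  ∣T∩S∣≡∣S∩T∣ T = cong ∣_∣ (∩-comm T S)

  toDiffers : ∀ {T} → Adjacent n (suc k) S T → Differs S 1 1 T
  toDiffers {T} (_ , ∣T∣≡1+k , ∣S∩T∣≡k) =
    from (∣p∩∁q∣≡1⇔∣p∩q∣≡k S T ∣S∣≡1+k) ∣S∩T∣≡k ,
    from (∣p∩∁q∣≡1⇔∣p∩q∣≡k T S ∣T∣≡1+k) (trans (∣T∩S∣≡∣S∩T∣ T) ∣S∩T∣≡k)

  fromDiffers : ∀ {T} → Differs S 1 1 T → Adjacent n (suc k) S T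
  fromDiffers {T} (∣S∩∁T∣≡1 , ∣T∩∁S∣≡1) = ∣S∣≡1+k , ∣T∣≡1+k , ∣S∩T∣≡k
    where
    ∣S∩T∣≡k : ∣ S ∩ T ∣ ≡ k
    ∣S∩T∣≡k = to (∣p∩∁q∣≡1⇔∣p∩q∣≡k S T ∣S∣≡1+k) ∣S∩∁T∣≡1
    ∣T∣≡1+k : ∣ T ∣ ≡ suc k
    ∣T∣≡1+k = trans (∣p∣≡∣p∩∁q∣+∣p∩q∣ T S) (cong₂ _+_ ∣T∩∁S∣≡1 (trans (∣T∩S∣≡∣S∩T∣ T) ∣S∩T∣≡k))

count-adjacent≡count-differs : ∀ {m n k} (S : Subset n) → ∣ S ∣ ≡ suc k → (f : Subset m → Subset n) →
  ∀ xs → count (adjacent? n (suc k) S ∘ f) xs ≡ count (differs? S 1 1 ∘ f) xs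
count-adjacent≡count-differs {n = n} {k} S ∣S∣≡1+k f =
  count-≐ (adjacent? n (suc k) S ∘ f) (differs? S 1 1 ∘ f) (proj₁ A≐D , proj₂ A≐D)
  where
  A≐D : Adjacent n (suc k) S ≐ Differs S 1 1
  A≐D = adjacent≐differs S ∣S∣≡1+k

starVector : ∀ {m} → ℤ → ℤ → Subset (suc m) → ℤ
starVector x y (inside ∷ _) = x
starVector x y (outside ∷ _) = y

adjApply-starVector : ∀ {m} k x y (S : Subset (suc m)) → adjApply (suc m) k (starVector x y) S
  ≡ + count (adjacent? (suc m) k S ∘ (outside ∷_)) (allSubsets m) ℤ.* y
    ℤ.+ + count (adjacent? (suc m) k S ∘ (inside ∷_)) (allSubsets m) ℤ.* x
adjApply-starVector {m} k x y S = begin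
  sumℤ (map v (filter adj? (map (outside ∷_) L ++ map (inside ∷_) L)))
    ≡⟨ cong (sumℤ ∘ map v) (filter-++ adj? (map (outside ∷_) L) _) ⟩
  sumℤ (map v (neighboursVia (outside ∷_) ++ neighboursVia (inside ∷_)))
    ≡⟨ cong sumℤ (map-++ v (neighboursVia (outside ∷_)) _) ⟩
  sumℤ (map v (neighboursVia (outside ∷_)) ++ map v (neighboursVia (inside ∷_)))
    ≡⟨ sumℤ-++ (map v (neighboursVia (outside ∷_))) _ ⟩
  sumℤ (map v (neighboursVia (outside ∷_))) ℤ.+ sumℤ (map v (neighboursVia (inside ∷_)))
    ≡⟨ cong₂ ℤ._+_ (sumℤ-filter-map-const adj? (outside ∷_) v (λ _ → refl) L)
                   (sumℤ-filter-map-const adj? (inside ∷_) v (λ _ → refl) L) ⟩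
  + count (adj? ∘ (outside ∷_)) L ℤ.* y ℤ.+ + count (adj? ∘ (inside ∷_)) L ℤ.* x ∎
  where
  v : Subset (suc m) → ℤ
  v = starVector x y
  L : List (Subset m)
  L = allSubsets m
  adj? : Decidable (Adjacent (suc m) k S)
  adj? = adjacent? (suc m) k S
  neighboursVia : (Subset m → Subset (suc m)) → List (Subset (suc m))
  neighboursVia f = filter adj? (map f L)

module _ {m k : ℕ} (x y : ℤ) (S : Subset m) where

  private
    L : List (Subset m)
    L = allSubsets m

  adjApply-starVector-inside : ∣ S ∣ ≡ k →
    adjApply (suc m) (suc k) (starVector x y) (inside ∷ S) ≡ + ∣ ∁ S ∣ ℤ.* y ℤ.+ + (k * ∣ ∁ S ∣) ℤ.* x
  adjApply-starVector-inside ∣S∣≡k =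
    trans (adjApply-starVector (suc k) x y (inside ∷ S)) (cong₂ (λ a b → + a ℤ.* y ℤ.+ + b ℤ.* x) out-count in-count)
    where
    S′ : Subset (suc m)
    S′ = inside ∷ S
    out-count : count (adjacent? (suc m) (suc k) S′ ∘ (outside ∷_)) L ≡ ∣ ∁ S ∣
    out-count = begin
      count (adjacent? (suc m) (suc k) S′ ∘ (outside ∷_)) L ≡⟨ count-adjacent≡count-differs S′ (cong suc ∣S∣≡k) (outside ∷_) L ⟩
      count (differs? S′ 1 1 ∘ (outside ∷_)) L ≡⟨ count-differs-inside-outside S 0 1 L ⟩
      count (differs? S 0 1) L ≡⟨ count-Differs S 0 1 ⟩
      (∣ S ∣ C 0) * (∣ ∁ S ∣ C 1) ≡⟨ trans (*-identityˡ _) (nC1≡n ∣ ∁ S ∣) ⟩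
      ∣ ∁ S ∣ ∎
    in-count : count (adjacent? (suc m) (suc k) S′ ∘ (inside ∷_)) L ≡ k * ∣ ∁ S ∣
    in-count = begin
      count (adjacent? (suc m) (suc k) S′ ∘ (inside ∷_)) L ≡⟨ count-adjacent≡count-differs S′ (cong suc ∣S∣≡k) (inside ∷_) L ⟩
      count (differs? S 1 1) L ≡⟨ count-Differs S 1 1 ⟩
      (∣ S ∣ C 1) * (∣ ∁ S ∣ C 1) ≡⟨ cong₂ _*_ (trans (nC1≡n ∣ S ∣) ∣S∣≡k) (nC1≡n ∣ ∁ S ∣) ⟩
      k * ∣ ∁ S ∣ ∎

  adjApply-starVector-outside : ∣ S ∣ ≡ suc k →
    adjApply (suc m) (suc k) (starVector x y) (outside ∷ S) ≡ + (suc k * ∣ ∁ S ∣) ℤ.* y ℤ.+ + suc k ℤ.* x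
  adjApply-starVector-outside ∣S∣≡1+k =
    trans (adjApply-starVector (suc k) x y (outside ∷ S)) (cong₂ (λ a b → + a ℤ.* y ℤ.+ + b ℤ.* x) out-count in-count)
    where
    S′ : Subset (suc m)
    S′ = outside ∷ S
    out-count : count (adjacent? (suc m) (suc k) S′ ∘ (outside ∷_)) L ≡ suc k * ∣ ∁ S ∣
    out-count = begin
      count (adjacent? (suc m) (suc k) S′ ∘ (outside ∷_)) L ≡⟨ count-adjacent≡count-differs S′ ∣S∣≡1+k (outside ∷_) L ⟩
      count (differs? S 1 1) L ≡⟨ count-Differs S 1 1 ⟩
      (∣ S ∣ C 1) * (∣ ∁ S ∣ C 1) ≡⟨ cong₂ _*_ (trans (nC1≡n ∣ S ∣) ∣S∣≡1+k) (nC1≡n ∣ ∁ S ∣) ⟩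
      suc k * ∣ ∁ S ∣ ∎
    in-count : count (adjacent? (suc m) (suc k) S′ ∘ (inside ∷_)) L ≡ suc k
    in-count = begin
      count (adjacent? (suc m) (suc k) S′ ∘ (inside ∷_)) L ≡⟨ count-adjacent≡count-differs S′ ∣S∣≡1+k (inside ∷_) L ⟩
      count (differs? S′ 1 1 ∘ (inside ∷_)) L ≡⟨ count-differs-outside-inside S 1 0 L ⟩
      count (differs? S 1 0) L ≡⟨ count-Differs S 1 0 ⟩
      (∣ S ∣ C 1) * (∣ ∁ S ∣ C 0) ≡⟨ trans (*-identityʳ _) (nC1≡n ∣ S ∣) ⟩
      ∣ S ∣ ≡⟨ ∣S∣≡1+k ⟩
      suc k ∎

θ₁≡[k-1][n-k-1]-1 : ∀ {n k} → k ≤ n → θ₁ n k ≡ (+ k ℤ.- 1ℤ) ℤ.* (+ (n ∸ k) ℤ.- 1ℤ) ℤ.- 1ℤ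
θ₁≡[k-1][n-k-1]-1 {n} {k} k≤n =
  cong (λ d → (+ k ℤ.- 1ℤ) ℤ.* (d ℤ.- 1ℤ) ℤ.- 1ℤ) (trans (ℤ.[+m]-[+n]≡m⊖n n k) (ℤ.⊖-≥ k≤n))

-- Here k plays the role of (vertex size - 1), so that 1ℤ ℤ.+ k is definitionally + suc k.
eigen-identity-inside : ∀ k b c u → (1ℤ ℤ.+ k) ℤ.* c ≡ b ℤ.* u →
  u ℤ.* - b ℤ.+ (k ℤ.* u) ℤ.* c ≡ ((1ℤ ℤ.+ k ℤ.- 1ℤ) ℤ.* (u ℤ.- 1ℤ) ℤ.- 1ℤ) ℤ.* c
eigen-identity-inside k b c u kc≡bu = begin
  u ℤ.* - b ℤ.+ (k ℤ.* u) ℤ.* c                     ≡⟨ lhs-normal k b c u ⟩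
  k ℤ.* u ℤ.* c ℤ.- b ℤ.* u                         ≡⟨ cong (λ t → k ℤ.* u ℤ.* c ℤ.- t) kc≡bu ⟨
  k ℤ.* u ℤ.* c ℤ.- (1ℤ ℤ.+ k) ℤ.* c                ≡⟨ rhs-normal k c u ⟨
  ((1ℤ ℤ.+ k ℤ.- 1ℤ) ℤ.* (u ℤ.- 1ℤ) ℤ.- 1ℤ) ℤ.* c   ∎
  where
  lhs-normal : ∀ k b c u → u ℤ.* - b ℤ.+ (k ℤ.* u) ℤ.* c ≡ k ℤ.* u ℤ.* c ℤ.- b ℤ.* u
  lhs-normal = solve-∀
  rhs-normal : ∀ k c u → ((1ℤ ℤ.+ k ℤ.- 1ℤ) ℤ.* (u ℤ.- 1ℤ) ℤ.- 1ℤ) ℤ.* c ≡ k ℤ.* u ℤ.* c ℤ.- (1ℤ ℤ.+ k) ℤ.* c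
  rhs-normal = solve-∀

eigen-identity-outside : ∀ k b c z → (1ℤ ℤ.+ k) ℤ.* c ≡ b ℤ.* (1ℤ ℤ.+ z) →
  ((1ℤ ℤ.+ k) ℤ.* z) ℤ.* - b ℤ.+ (1ℤ ℤ.+ k) ℤ.* c ≡ ((1ℤ ℤ.+ k ℤ.- 1ℤ) ℤ.* (1ℤ ℤ.+ z ℤ.- 1ℤ) ℤ.- 1ℤ) ℤ.* - b
eigen-identity-outside k b c z kc≡bu = begin
  ((1ℤ ℤ.+ k) ℤ.* z) ℤ.* - b ℤ.+ (1ℤ ℤ.+ k) ℤ.* c   ≡⟨ cong (λ t → ((1ℤ ℤ.+ k) ℤ.* z) ℤ.* - b ℤ.+ t) kc≡bu ⟩
  ((1ℤ ℤ.+ k) ℤ.* z) ℤ.* - b ℤ.+ b ℤ.* (1ℤ ℤ.+ z)   ≡⟨ normal k b z ⟩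
  ((1ℤ ℤ.+ k ℤ.- 1ℤ) ℤ.* (1ℤ ℤ.+ z ℤ.- 1ℤ) ℤ.- 1ℤ) ℤ.* - b ∎
  where
  normal : ∀ k b z → ((1ℤ ℤ.+ k) ℤ.* z) ℤ.* - b ℤ.+ b ℤ.* (1ℤ ℤ.+ z)
                   ≡ ((1ℤ ℤ.+ k ℤ.- 1ℤ) ℤ.* (1ℤ ℤ.+ z ℤ.- 1ℤ) ℤ.- 1ℤ) ℤ.* - b
  normal = solve-∀

pos-*-≡ : ∀ m n o p → m * n ≡ o * p → + m ℤ.* + n ≡ + o ℤ.* + p
pos-*-≡ m n o p mn≡op = trans (sym (ℤ.pos-* m n)) (trans (cong +_ mn≡op) (ℤ.pos-* o p))

starVector-isEigenvector : ∀ {m k b c} → suc k ≤ suc m → suc k * c ≡ b * (m ∸ k) →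
  (S : Subset (suc m)) → IsVertex (suc m) (suc k) S →
  adjApply (suc m) (suc k) (starVector (+ c) (- + b)) S ≡ θ₁ (suc m) (suc k) ℤ.* starVector (+ c) (- + b) S
starVector-isEigenvector {m} {k} {b} {c} k≤n kc≡bu (inside ∷ S) ∣S∣+1≡k+1 = begin
  adjApply (suc m) (suc k) (starVector (+ c) (- + b)) (inside ∷ S)
    ≡⟨ adjApply-starVector-inside (+ c) (- + b) S ∣S∣≡k ⟩
  + ∣ ∁ S ∣ ℤ.* - + b ℤ.+ + (k * ∣ ∁ S ∣) ℤ.* + c
    ≡⟨ cong (λ z → + z ℤ.* - + b ℤ.+ + (k * z) ℤ.* + c) ∣∁S∣≡u ⟩
  + u ℤ.* - + b ℤ.+ + (k * u) ℤ.* + c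
    ≡⟨ cong (λ t → + u ℤ.* - + b ℤ.+ t ℤ.* + c) (ℤ.pos-* k u) ⟩
  + u ℤ.* - + b ℤ.+ (+ k ℤ.* + u) ℤ.* + c
    ≡⟨ eigen-identity-inside (+ k) (+ b) (+ c) (+ u) (pos-*-≡ (suc k) c b u kc≡bu) ⟩
  ((+ suc k ℤ.- 1ℤ) ℤ.* (+ u ℤ.- 1ℤ) ℤ.- 1ℤ) ℤ.* + c
    ≡⟨ cong (ℤ._* + c) (θ₁≡[k-1][n-k-1]-1 k≤n) ⟨
  θ₁ (suc m) (suc k) ℤ.* + c ∎
  where
  u : ℕ
  u = m ∸ k
  ∣S∣≡k : ∣ S ∣ ≡ k
  ∣S∣≡k = suc-injective ∣S∣+1≡k+1
  ∣∁S∣≡u : ∣ ∁ S ∣ ≡ u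
  ∣∁S∣≡u = trans (∣∁p∣≡n∸∣p∣ S) (cong (m ∸_) ∣S∣≡k)
starVector-isEigenvector {m} {k} {b} {c} k≤n kc≡bu (outside ∷ S) ∣S∣≡k+1 = begin
  adjApply (suc m) (suc k) (starVector (+ c) (- + b)) (outside ∷ S)
    ≡⟨ adjApply-starVector-outside (+ c) (- + b) S ∣S∣≡k+1 ⟩
  + (suc k * z) ℤ.* - + b ℤ.+ + suc k ℤ.* + c
    ≡⟨ cong (λ t → t ℤ.* - + b ℤ.+ + suc k ℤ.* + c) (ℤ.pos-* (suc k) z) ⟩
  (+ suc k ℤ.* + z) ℤ.* - + b ℤ.+ + suc k ℤ.* + c
    ≡⟨ eigen-identity-outside (+ k) (+ b) (+ c) (+ z) (pos-*-≡ (suc k) c b (suc z) (trans kc≡bu (cong (b *_) u≡1+z))) ⟩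
  ((+ suc k ℤ.- 1ℤ) ℤ.* (+ suc z ℤ.- 1ℤ) ℤ.- 1ℤ) ℤ.* - + b
    ≡⟨ cong (λ t → ((+ suc k ℤ.- 1ℤ) ℤ.* (+ t ℤ.- 1ℤ) ℤ.- 1ℤ) ℤ.* - + b) u≡1+z ⟨
  ((+ suc k ℤ.- 1ℤ) ℤ.* (+ (m ∸ k) ℤ.- 1ℤ) ℤ.- 1ℤ) ℤ.* - + b
    ≡⟨ cong (ℤ._* - + b) (θ₁≡[k-1][n-k-1]-1 k≤n) ⟨
  θ₁ (suc m) (suc k) ℤ.* - + b ∎
  where
  z : ℕ
  z = ∣ ∁ S ∣
  k<m : suc k ≤ m
  k<m = subst (_≤ m) ∣S∣≡k+1 (∣p∣≤n S)
  u≡1+z : m ∸ k ≡ suc z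
  u≡1+z = trans (+-∸-assoc 1 k<m) (cong suc (sym (trans (∣∁p∣≡n∸∣p∣ S) (cong (m ∸_) ∣S∣≡k+1))))

starVector-nonzero : ∀ {m b c} → b ≢ 0 → c ≢ 0 → (S : Subset (suc m)) → starVector (+ c) (- + b) S ≢ 0ℤ
starVector-nonzero b≢0 c≢0 (inside ∷ _) = c≢0 ∘ ℤ.+-injective
starVector-nonzero b≢0 c≢0 (outside ∷ _) = b≢0 ∘ ℤ.+-injective ∘ ℤ.neg-injective

starVector-bounded : ∀ {m b c} → b ≤ c → (S : Subset (suc m)) → ℤ.∣ starVector (+ c) (- + b) S ∣ ≤ c
starVector-bounded b≤c (inside ∷ _) = ≤-refl
starVector-bounded {b = b} b≤c (outside ∷ _) = ≤-trans (≤-reflexive (ℤ.∣-i∣≡∣i∣ (+ b))) b≤c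

m*[n/d]≡[m/d]*n : ∀ m n {d} .{{_ : NonZero d}} → d ∣ m → d ∣ n → m * (n / d) ≡ (m / d) * n
m*[n/d]≡[m/d]*n m n {d} d∣m d∣n = begin
  m * (n / d)  ≡⟨ *-/-assoc m d∣n ⟨
  m * n / d    ≡⟨ /-congˡ (*-comm m n) ⟩
  n * m / d    ≡⟨ *-/-assoc n d∣m ⟩
  n * (m / d)  ≡⟨ *-comm n (m / d) ⟩
  (m / d) * n  ∎

proposition5 : (n k : ℕ) → .{{_ : NonZero k}} → 2 * k ≤ n →
    Σ (Subset n → ℤ) (λ v →
      IsNZIEigenvector n k (θ₁ n k) v × SupNormLE n k v (johnsonBound n k))
proposition5 n@(suc m) k@(suc _) 2k≤n =
  starVector (+ c) (- + b) ,
  ((λ S _ → starVector-nonzero b≢0 c≢0 S) , starVector-isEigenvector k≤n kc≡bu) ,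
  (λ S _ → starVector-bounded b≤c S)
  where
  k≤n : k ≤ n
  k≤n = m+n≤o⇒m≤o k 2k≤n
  k≤u : k ≤ n ∸ k
  k≤u = m+n≤o⇒m≤o∸n k (subst (λ t → k + t ≤ n) (+-identityʳ k) 2k≤n)
  g : ℕ
  g = gcd n k
  instance
    g≢0 : NonZero g
    g≢0 = ℕ.≢-nonZero (gcd[m,n]≢0 n k (inj₂ λ ()))
  g∣k : g ∣ k
  g∣k = gcd[m,n]∣n n k
  g∣u : g ∣ n ∸ k
  g∣u = ∣m+n∣m⇒∣n (subst (g ∣_) (sym (m+[n∸m]≡n k≤n)) (gcd[m,n]∣m n k)) g∣k
  b c : ℕ
  b = k / g
  c = johnsonBound n k
  kc≡bu : k * c ≡ b * (n ∸ k)
  kc≡bu = m*[n/d]≡[m/d]*n k (n ∸ k) g∣k g∣u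
  b≤c : b ≤ c
  b≤c = /-monoˡ-≤ g k≤u
  b≢0 : b ≢ 0
  b≢0 = n>0⇒n≢0 (m≥n⇒m/n>0 (∣⇒≤ g∣k))
  c≢0 : c ≢ 0
  c≢0 = n>0⇒n≢0 (m≥n⇒m/n>0 (≤-trans (∣⇒≤ g∣k) k≤u))
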